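{- The category of all weakly dominated dcpo's is $\Gamma$-faithful: if $L$ and $P$ are weakly dominated dcpo's with $\Gamma L\cong \Gamma P$ (order-isomorphic), then $L\cong P$.
   Context: A dcpo is a poset in which every directed subset has a supremum. For a poset $P$, Scott closed sets are lower sets closed under suprema (when they exist) of directed subsets; $\Gamma P$ denotes the set of Scott closed subsets ordered by inclusion; $\mathrm{cl}(B)$ is the Scott closure of $B$. For elements $x,y$ of a poset $Q$, write $x\prec^* y$ if for every nonempty Scott closed set $C\subseteq Q$ for which $\sup C$ exists, $y\le \sup C$ implies $x\in C$. An element $x$ is $C$-compact if $x\prec^* x$. For a poset $L$, $C(\Gamma L)$ denotes the set of $C$-compact elements of the poset $\Gamma L$, ordered by inclusion. For $A,B\in C(\Gamma L)$ write $A\lhd B$ if there is $x\in B$ with $A\subseteq\downarrow x$, and $\nabla B=\{A\in C(\Gamma L): A\lhd B\}$. A dcpo $L$ is weakly dominated if for every $A\in C(\Gamma L)$, $\nabla A$ is Scott closed in the poset $C(\Gamma L)$. -}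

module Defs where

open import Level using (Level; 0ℓ; _⊔_) renaming (suc to lsuc)
open import Data.Product using (Σ; ∃; _×_; _,_; proj₁; proj₂)
open import Relation.Unary using (Pred)
open import Relation.Binary.Bundles using (Poset)
open import Relation.Binary.Structures using (IsPartialOrder; IsPreorder; IsEquivalence)
open import Function using (_∘_)

module PosetNotions {c ℓ₁ ℓ₂ : Level} (Q : Poset c ℓ₁ ℓ₂) where
  open Poset Q

  Subset : Set (c ⊔ lsuc 0ℓ)
  Subset = Pred Carrier 0ℓ

  _⊆ₛ_ : Subset → Subset → Set c
  S ⊆ₛ T = ∀ x → S x → T x

  NonEmpty : Subset → Set c
  NonEmpty S = ∃ λ x → S x

  IsUpperBound : Subset → Carrier → Set (c ⊔ ℓ₂)
  IsUpperBound S u = ∀ x → S x → x ≤ u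

  IsSup : Subset → Carrier → Set (c ⊔ ℓ₂)
  IsSup S s = IsUpperBound S s × (∀ u → IsUpperBound S u → s ≤ u)

  Directed : Subset → Set (c ⊔ ℓ₂)
  Directed D = NonEmpty D × (∀ x y → D x → D y → ∃ λ z → D z × x ≤ z × y ≤ z)

  IsLower : Subset → Set (c ⊔ ℓ₂)
  IsLower S = ∀ x y → S x → y ≤ x → S y

  IsScottClosed : Subset → Set (lsuc 0ℓ ⊔ c ⊔ ℓ₂)
  IsScottClosed S = IsLower S
                  × (∀ (D : Subset) → Directed D → D ⊆ₛ S → ∀ s → IsSup D s → S s)

  IsDcpo : Set (lsuc 0ℓ ⊔ c ⊔ ℓ₂)
  IsDcpo = ∀ (D : Subset) → Directed D → ∃ λ s → IsSup D s

  _≺*_ : Carrier → Carrier → Set (lsuc 0ℓ ⊔ c ⊔ ℓ₂)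
  x ≺* y = ∀ (C : Subset) → NonEmpty C → IsScottClosed C
           → ∀ s → IsSup C s → y ≤ s → C x

  IsCCompact : Carrier → Set (lsuc 0ℓ ⊔ c ⊔ ℓ₂)
  IsCCompact x = x ≺* x

  subPoset : ∀ {p} → Pred Carrier p → Poset (c ⊔ p) ℓ₁ ℓ₂
  subPoset P = record
    { Carrier = Σ Carrier P
    ; _≈_ = λ a b → proj₁ a ≈ proj₁ b
    ; _≤_ = λ a b → proj₁ a ≤ proj₁ b
    ; isPartialOrder = record
      { isPreorder = record
        { isEquivalence = record
          { refl = Eq.refl ; sym = Eq.sym ; trans = Eq.trans }
        ; reflexive = reflexive
        ; trans = trans
        }
      ; antisym = antisym
      }
    }

record _≅_ {c ℓ₁ ℓ₂ c' ℓ₁' ℓ₂'} (P : Poset c ℓ₁ ℓ₂) (Q : Poset c' ℓ₁' ℓ₂')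
       : Set (c ⊔ ℓ₁ ⊔ ℓ₂ ⊔ c' ⊔ ℓ₁' ⊔ ℓ₂') where
  module P = Poset P
  module Q = Poset Q
  field
    to        : P.Carrier → Q.Carrier
    from      : Q.Carrier → P.Carrier
    to-mono   : ∀ {x y} → x P.≤ y → to x Q.≤ to y
    from-mono : ∀ {x y} → x Q.≤ y → from x P.≤ from y
    from∘to   : ∀ x → from (to x) P.≈ x
    to∘from   : ∀ y → to (from y) Q.≈ y

-- Γ L : the Scott closed subsets of L ordered by inclusion
-- (equality = mutual inclusion, since there is no set extensionality)
Γ : Poset 0ℓ 0ℓ 0ℓ → Poset (lsuc 0ℓ) 0ℓ 0ℓ
Γ L = record
  { Carrier = Σ Subset IsScottClosed
  ; _≈_ = λ A B → (proj₁ A ⊆ₛ proj₁ B) × (proj₁ B ⊆ₛ proj₁ A)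
  ; _≤_ = λ A B → proj₁ A ⊆ₛ proj₁ B
  ; isPartialOrder = record
    { isPreorder = record
      { isEquivalence = record
        { refl = (λ _ p → p) , (λ _ p → p)
        ; sym = λ (f , g) → g , f
        ; trans = λ (f , g) (h , k) → (λ x p → h x (f x p)) , (λ x p → g x (k x p))
        }
      ; reflexive = proj₁
      ; trans = λ f g x p → g x (f x p)
      }
    ; antisym = _,_
    }
  }
  where open PosetNotions L

CΓ : Poset 0ℓ 0ℓ 0ℓ → Poset (lsuc 0ℓ) 0ℓ 0ℓ
CΓ L = PosetNotions.subPoset (Γ L) (PosetNotions.IsCCompact (Γ L))

module _ (L : Poset 0ℓ 0ℓ 0ℓ) where
  open Poset L
  private module CΓL = Poset (CΓ L)

  _◁_ : CΓL.Carrier → CΓL.Carrier → Set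
  A ◁ B = ∃ λ x → proj₁ (proj₁ B) x × (∀ y → proj₁ (proj₁ A) y → y ≤ x)

  ∇ : CΓL.Carrier → Pred CΓL.Carrier 0ℓ
  ∇ B A = A ◁ B

  IsWeaklyDominated : Set (lsuc 0ℓ)
  IsWeaklyDominated = PosetNotions.IsDcpo L
                    × (∀ A → PosetNotions.IsScottClosed (CΓ L) (∇ A))

{-# OPTIONS --safe #-}
-- For Φ : Γ L ≅ Γ P the map y ↦ Φ(↓y) is monotone and preserves directed suprema, so it
-- pulls Scott closed sets back to Scott closed sets. This makes every Φ(↓x) C-compact and,
-- when P is weakly dominated, makes D = {y | Φ(↓y) ◁ Φ(↓x)} Scott closed. Each p ∈ Φ(↓x)
-- gives Φ⁻¹(↓p) ⊆ D, so Φ(↓x) ⊆ Φ(D) and x ∈ D: Φ(↓x) ◁ Φ(↓x), i.e. Φ(↓x) = ↓p. Hence Φ and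
-- Φ⁻¹ restrict to mutually inverse monotone maps between the principal ideals of L and P.
module Submission where

open import Defs
open import Level using (0ℓ; _⊔_) renaming (suc to lsuc)
open import Relation.Binary.Bundles using (Poset)
open import Relation.Binary.Core using (_Preserves_⟶_)
open import Relation.Unary using (Pred)
open import Data.Product using (∃; _×_; _,_; proj₁; proj₂)
open import Function using (_∘_)
import Relation.Binary.Reasoning.PartialOrder as PosetReasoning

module _ {c ℓ₁ ℓ₂ c′ ℓ₁′ ℓ₂′} {Q : Poset c ℓ₁ ℓ₂} {R : Poset c′ ℓ₁′ ℓ₂′} where
  private
    module Q = Poset Q
    module R = Poset R

  ≅-sym : Q ≅ R → R ≅ Q
  ≅-sym φ = record
    { to = from ; from = to ; to-mono = from-mono ; from-mono = to-mono
    ; from∘to = to∘from ; to∘from = from∘to }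
    where open _≅_ φ using (to; from; to-mono; from-mono; from∘to; to∘from)

  module _ (φ : Q ≅ R) where
    open _≅_ φ using (to; from; to-mono; from-mono; from∘to; to∘from)

    to-cong : ∀ {x y} → x Q.≈ y → to x R.≈ to y
    to-cong x≈y = R.antisym (to-mono (Q.reflexive x≈y)) (to-mono (Q.reflexive (Q.Eq.sym x≈y)))

    ≤-from⇒to-≤ : ∀ {x y} → x Q.≤ from y → to x R.≤ y
    ≤-from⇒to-≤ {y = y} x≤ = R.trans (to-mono x≤) (R.reflexive (to∘from y))

    to-≤⇒≤-from : ∀ {x y} → to x R.≤ y → x Q.≤ from y
    to-≤⇒≤-from {x} ≤y = Q.trans (Q.reflexive (Q.Eq.sym (from∘to x))) (from-mono ≤y)

    to-reflects-≤ : ∀ {x y} → to x R.≤ to y → x Q.≤ y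
    to-reflects-≤ {y = y} ≤to = Q.trans (to-≤⇒≤-from ≤to) (Q.reflexive (from∘to y))

module _ {c} (R : Poset c 0ℓ 0ℓ) where
  open Poset R

  image : {A : Set} → (A → Carrier) → Pred A 0ℓ → PosetNotions.Subset R
  image f D r = ∃ λ d → D d × r ≈ f d

module _ {c} (Q : Poset 0ℓ 0ℓ 0ℓ) (R : Poset c 0ℓ 0ℓ) where
  open PosetNotions using (Directed; IsSup)

  PreservesDirectedSups : (Poset.Carrier Q → Poset.Carrier R) → Set (lsuc 0ℓ ⊔ c)
  PreservesDirectedSups f =
    ∀ D → Directed Q D → ∀ t → IsSup Q D t → IsSup R (image R f D) (f t)

module _ {c} {Q : Poset 0ℓ 0ℓ 0ℓ} {R : Poset c 0ℓ 0ℓ} where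
  private
    module Q = Poset Q
    module R = Poset R
    module Qₙ = PosetNotions Q
    module Rₙ = PosetNotions R

  module _ {f : Q.Carrier → R.Carrier} (f-mono : f Preserves Q._≤_ ⟶ R._≤_) where

    image-directed : ∀ {D} → Qₙ.Directed D → Rₙ.Directed (image R f D)
    image-directed {D} ((d , Dd) , D-dir) = (f d , d , Dd , R.Eq.refl) , upper
      where
      upper : ∀ r r′ → image R f D r → image R f D r′ → ∃ λ s → image R f D s × r R.≤ s × r′ R.≤ s
      upper r r′ (d , Dd , r≈) (d′ , Dd′ , r′≈) =
        let (e , De , d≤e , d′≤e) = D-dir d d′ Dd Dd′
        in f e , (e , De , R.Eq.refl)
         , R.trans (R.reflexive r≈) (f-mono d≤e) , R.trans (R.reflexive r′≈) (f-mono d′≤e)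

    preimage-isScottClosed : PreservesDirectedSups Q R f →
                             ∀ {C} → Rₙ.IsScottClosed C → Qₙ.IsScottClosed (C ∘ f)
    preimage-isScottClosed f-sup {C} (C-lower , C-sup) = lower , sup
      where
      lower : Qₙ.IsLower (C ∘ f)
      lower x y Cfx y≤x = C-lower (f x) (f y) Cfx (f-mono y≤x)
      sup : ∀ D → Qₙ.Directed D → Qₙ._⊆ₛ_ D (C ∘ f) → ∀ t → Qₙ.IsSup D t → C (f t)
      sup D D-dir D⊆ t t-sup =
        C-sup (image R f D) (image-directed D-dir)
              (λ { r (d , Dd , r≈) → C-lower (f d) r (D⊆ d Dd) (R.reflexive r≈) })
              (f t) (f-sup D D-dir t t-sup)

module _ {c p} {Q : Poset 0ℓ 0ℓ 0ℓ} {R : Poset c 0ℓ 0ℓ} {Pr : Pred (Poset.Carrier R) p} where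
  private module R = Poset R

  corestrict-preservesDirectedSups :
    (f : Poset.Carrier Q → R.Carrier) (f∈Pr : ∀ x → Pr (f x)) →
    PreservesDirectedSups Q R f →
    PreservesDirectedSups Q (PosetNotions.subPoset R Pr) (λ x → f x , f∈Pr x)
  corestrict-preservesDirectedSups f f∈Pr f-sup D D-dir t t-sup
    with ub , least ← f-sup D D-dir t t-sup =
    (λ Z → ub (proj₁ Z)) ,
    λ u u-ub → least (proj₁ u) λ { r (d , Dd , r≈) →
      R.trans (R.reflexive r≈) (u-ub (f d , f∈Pr d) (d , Dd , R.Eq.refl)) }

module _ (L : Poset 0ℓ 0ℓ 0ℓ) where
  open Poset L
  private module ΓL = Poset (Γ L)

  ↓ : Carrier → ΓL.Carrier
  ↓ x = (λ z → z ≤ x) , (λ a b a≤x b≤a → trans b≤a a≤x) , (λ D _ D≤x s s-sup → proj₂ s-sup x D≤x)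

  ↓-mono : ↓ Preserves _≤_ ⟶ ΓL._≤_
  ↓-mono x≤y z z≤x = trans z≤x x≤y

  ∈⇒↓⊆ : ∀ (A : ΓL.Carrier) {y} → proj₁ A y → ↓ y ΓL.≤ A
  ∈⇒↓⊆ A {y} y∈A z z≤y = proj₁ (proj₂ A) y z y∈A z≤y

  ↓⊆⇒∈ : ∀ (A : ΓL.Carrier) {y} → ↓ y ΓL.≤ A → proj₁ A y
  ↓⊆⇒∈ A {y} ↓y⊆A = ↓y⊆A y refl

  ↓-injective : ∀ {x y} → ↓ x ΓL.≈ ↓ y → x ≈ y
  ↓-injective {x} {y} (↓x⊆↓y , ↓y⊆↓x) = antisym (↓⊆⇒∈ (↓ y) ↓x⊆↓y) (↓⊆⇒∈ (↓ x) ↓y⊆↓x)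

module _ {c} (L : Poset 0ℓ 0ℓ 0ℓ) {R : Poset c 0ℓ 0ℓ} (Φ : Γ L ≅ R) where
  open _≅_ Φ using (to; from; to-mono)
  private
    module L = Poset L
    module R = Poset R
    module Rₙ = PosetNotions R

  ↓-to-mono : (to ∘ ↓ L) Preserves L._≤_ ⟶ R._≤_
  ↓-to-mono = to-mono ∘ ↓-mono L

  ↓-to-preservesDirectedSups : PreservesDirectedSups L R (to ∘ ↓ L)
  ↓-to-preservesDirectedSups D D-dir t (t-ub , t-least) = ub , least
    where
    ub : Rₙ.IsUpperBound (image R (to ∘ ↓ L) D) (to (↓ L t))
    ub r (d , Dd , r≈) = R.trans (R.reflexive r≈) (↓-to-mono (t-ub d Dd))
    least : ∀ u → Rₙ.IsUpperBound (image R (to ∘ ↓ L) D) u → to (↓ L t) R.≤ u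
    least u u-ub = ≤-from⇒to-≤ Φ (∈⇒↓⊆ L (from u) t∈)
      where
      D⊆ : ∀ d → D d → proj₁ (from u) d
      D⊆ d Dd = ↓⊆⇒∈ L (from u) (to-≤⇒≤-from Φ (u-ub (to (↓ L d)) (d , Dd , R.Eq.refl)))
      t∈ : proj₁ (from u) t
      t∈ = proj₂ (proj₂ (from u)) D D-dir D⊆ t (t-ub , t-least)

  ↓-to-isCCompact : ∀ x → Rₙ.IsCCompact (to (↓ L x))
  ↓-to-isCCompact x 𝒞 _ 𝒞-closed@(𝒞-lower , _) s (_ , s-least) ↓x≤s =
    ↓⊆⇒∈ L D (to-reflects-≤ Φ (R.trans ↓x≤s (s-least (to D) 𝒞≤D)))
    where
    D : Poset.Carrier (Γ L)
    D = 𝒞 ∘ to ∘ ↓ L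
      , preimage-isScottClosed {Q = L} {R = R} ↓-to-mono ↓-to-preservesDirectedSups 𝒞-closed
    𝒞≤D : Rₙ.IsUpperBound 𝒞 (to D)
    𝒞≤D A 𝒞A = to-≤⇒≤-from (≅-sym Φ) λ y y∈ →
      𝒞-lower A (to (↓ L y)) 𝒞A (≤-from⇒to-≤ Φ (∈⇒↓⊆ L (from A) y∈))

module _ (L P : Poset 0ℓ 0ℓ 0ℓ) where
  PreservesPrincipals : Γ L ≅ Γ P → Set
  PreservesPrincipals Φ = ∀ x → ∃ λ p → Poset._≈_ (Γ P) (_≅_.to Φ (↓ L x)) (↓ P p)

  private
    module L = Poset L
    module ΓL = Poset (Γ L)
    module ΓP = Poset (Γ P)

  ∇-closed⇒preservesPrincipals : (∀ A → PosetNotions.IsScottClosed (CΓ P) (∇ P A)) →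
                                 (Φ : Γ L ≅ Γ P) → PreservesPrincipals Φ
  ∇-closed⇒preservesPrincipals ∇-closed Φ x =
    let (p , p∈ , ↓x⊆↓p) = κx◁κx in p , ↓x⊆↓p , ∈⇒↓⊆ P (to (↓ L x)) p∈
    where
    open _≅_ Φ using (to; from)
    κ : L.Carrier → Poset.Carrier (CΓ P)
    κ y = to (↓ L y) , ↓-to-isCCompact L Φ y
    D : ΓL.Carrier
    D = ∇ P (κ x) ∘ κ
      , preimage-isScottClosed {Q = L} {R = CΓ P} {κ} (↓-to-mono L Φ)
          (corestrict-preservesDirectedSups {Q = L} {R = Γ P} (to ∘ ↓ L) (↓-to-isCCompact L Φ)
            (↓-to-preservesDirectedSups L Φ))
          (∇-closed (κ x))
    ↓x⊆D : to (↓ L x) ΓP.≤ to D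
    ↓x⊆D p p∈ = ↓⊆⇒∈ P (to D) (to-≤⇒≤-from (≅-sym Φ) λ y y∈ →
      p , p∈ , ≤-from⇒to-≤ Φ (∈⇒↓⊆ L (from (↓ P p)) y∈))
    κx◁κx : _◁_ P (κ x) (κ x)
    κx◁κx = ↓⊆⇒∈ L D (to-reflects-≤ Φ ↓x⊆D)

module PrincipalMap (L P : Poset 0ℓ 0ℓ 0ℓ) (Φ : Γ L ≅ Γ P) (pres : PreservesPrincipals L P Φ) where
  open _≅_ Φ using (to; to-mono)
  private
    module L = Poset L
    module P = Poset P

  map : L.Carrier → P.Carrier
  map x = proj₁ (pres x)

  to-↓≈↓-map : ∀ x → Poset._≈_ (Γ P) (to (↓ L x)) (↓ P (map x))
  to-↓≈↓-map x = proj₂ (pres x)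

  map-mono : map Preserves L._≤_ ⟶ P._≤_
  map-mono {x} {y} x≤y = ↓⊆⇒∈ P (↓ P (map y)) (begin
    ↓ P (map x)  ≈⟨ to-↓≈↓-map x ⟨
    to (↓ L x)   ≤⟨ to-mono (↓-mono L x≤y) ⟩
    to (↓ L y)   ≈⟨ to-↓≈↓-map y ⟩
    ↓ P (map y)  ∎)
    where open PosetReasoning (Γ P)

module _ (L P : Poset 0ℓ 0ℓ 0ℓ) (Φ : Γ L ≅ Γ P)
         (pres : PreservesPrincipals L P Φ) (pres⁻¹ : PreservesPrincipals P L (≅-sym Φ)) where
  open _≅_ Φ using (to; from; from∘to)
  private
    module F = PrincipalMap L P Φ pres
    module G = PrincipalMap P L (≅-sym Φ) pres⁻¹

  principalMap-inverse : ∀ x → Poset._≈_ L (G.map (F.map x)) x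
  principalMap-inverse x = ↓-injective L (begin-equality
    ↓ L (G.map (F.map x))  ≈⟨ G.to-↓≈↓-map (F.map x) ⟨
    from (↓ P (F.map x))   ≈⟨ to-cong (≅-sym Φ) (F.to-↓≈↓-map x) ⟨
    from (to (↓ L x))      ≈⟨ from∘to (↓ L x) ⟩
    ↓ L x                  ∎)
    where open PosetReasoning (Γ L)

principalsPreserving⇒≅ : {L P : Poset 0ℓ 0ℓ 0ℓ} (Φ : Γ L ≅ Γ P) →
                         PreservesPrincipals L P Φ → PreservesPrincipals P L (≅-sym Φ) → L ≅ P
principalsPreserving⇒≅ {L} {P} Φ pres pres⁻¹ = record
  { to        = F.map
  ; from      = G.map
  ; to-mono   = F.map-mono
  ; from-mono = G.map-mono
  ; from∘to   = principalMap-inverse L P Φ pres pres⁻¹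
  ; to∘from   = principalMap-inverse P L (≅-sym Φ) pres⁻¹ pres
  }
  where
  module F = PrincipalMap L P Φ pres
  module G = PrincipalMap P L (≅-sym Φ) pres⁻¹

mainTheorem3 : (L P : Poset 0ℓ 0ℓ 0ℓ)
               → IsWeaklyDominated L → IsWeaklyDominated P
               → Γ L ≅ Γ P → L ≅ P
mainTheorem3 L P (_ , ∇L-closed) (_ , ∇P-closed) Φ =
  principalsPreserving⇒≅ Φ (∇-closed⇒preservesPrincipals L P ∇P-closed Φ)
                           (∇-closed⇒preservesPrincipals P L ∇L-closed (≅-sym Φ))
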